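{- If $G$ is a connected graph with ${\rm diam}(G)\le 3$, then $\mu_i(G)=\alpha(G)$.
   Context: All graphs are finite, simple, undirected. ${\rm diam}(G)$ is the maximum distance between two vertices, and $\alpha(G)$ is the independence number. For $X\subseteq V(G)$, two vertices $x,y\in X$ are $X$-visible if there is a shortest $x,y$-path $P$ in $G$ with $V(P)\cap X=\{x,y\}$; $X$ is a mutual-visibility set if all pairs of its vertices are $X$-visible. $\mu_i(G)$ is the largest size of a mutual-visibility set of $G$ that is also an independent set. -}

module Defs where

open import Data.Nat using (ℕ; zero; suc; _≤_)
open import Data.Bool using (Bool; true; false)
open import Data.Fin using (Fin; zero; suc; inject₁; fromℕ)
open import Data.Fin.Subset using (Subset; _∈_; ∣_∣)
open import Data.Vec using (Vec; lookup)
open import Data.Product using (Σ; ∃; _×_; _,_)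
open import Data.Sum using (_⊎_)
open import Relation.Binary.PropositionalEquality using (_≡_)
open import Relation.Nullary using (¬_)

record Graph (n : ℕ) : Set where
  field
    adj    : Fin n → Fin n → Bool
    sym    : ∀ u v → adj u v ≡ adj v u
    irrefl : ∀ u → adj u u ≡ false

module _ {n : ℕ} (G : Graph n) where
  open Graph G

  Adj : Fin n → Fin n → Set
  Adj u v = adj u v ≡ true

  -- w is an x,y-walk of length k (k edges, k+1 vertices w[0..k]).
  IsWalk : Fin n → Fin n → (k : ℕ) → Vec (Fin n) (suc k) → Set
  IsWalk x y k w =
    (lookup w zero ≡ x) × (lookup w (fromℕ k) ≡ y) ×
    (∀ (i : Fin k) → Adj (lookup w (inject₁ i)) (lookup w (suc i)))

  HasWalk : Fin n → Fin n → ℕ → Set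
  HasWalk x y k = Σ (Vec (Fin n) (suc k)) (IsWalk x y k)

  IsDist : Fin n → Fin n → ℕ → Set
  IsDist x y d = HasWalk x y d × (∀ k → HasWalk x y k → d ≤ k)

  IsShortestPath : Fin n → Fin n → (k : ℕ) → Vec (Fin n) (suc k) → Set
  IsShortestPath x y k w = IsWalk x y k w × IsDist x y k

  Connected : Set
  Connected = ∀ x y → ∃ λ k → HasWalk x y k

  DiamAtMost : ℕ → Set
  DiamAtMost D = ∀ x y → ∃ λ d → IsDist x y d × d ≤ D

  Independent : Subset n → Set
  Independent X = ∀ u v → u ∈ X → v ∈ X → ¬ Adj u v

  Visible : Subset n → Fin n → Fin n → Set
  Visible X x y = ∃ λ k → Σ (Vec (Fin n) (suc k)) λ w →
    IsShortestPath x y k w ×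
    (∀ (i : Fin (suc k)) → lookup w i ∈ X → (lookup w i ≡ x ⊎ lookup w i ≡ y))

  MutualVisibility : Subset n → Set
  MutualVisibility X = ∀ x y → x ∈ X → y ∈ X → Visible X x y

  IndependentMV : Subset n → Set
  IndependentMV X = MutualVisibility X × Independent X

IsMaxSize : {n : ℕ} → (Subset n → Set) → ℕ → Set
IsMaxSize {n} P m = (Σ (Subset n) λ S → P S × ∣ S ∣ ≡ m) × (∀ S → P S → ∣ S ∣ ≤ m)

IsIndependenceNumber : {n : ℕ} → Graph n → ℕ → Set
IsIndependenceNumber G = IsMaxSize (Independent G)

IsMuI : {n : ℕ} → Graph n → ℕ → Set
IsMuI G = IsMaxSize (IndependentMV G)

{-# OPTIONS --safe #-}
module Submission where

-- On a walk
-- of length at most 3 every inner vertex is a neighbour of an end vertex, so a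
-- shortest path between two vertices of X avoids X in its interior. With
-- diameter at most 3 this makes every independent set a mutual-visibility set,
-- hence the independent mutual-visibility sets are exactly the independent sets.

open import Defs
open import Data.Nat using (ℕ; suc; _≤_; s≤s)
open import Data.Product using (_×_; _,_; proj₂)
open import Data.Sum using (_⊎_; inj₁; inj₂)
open import Data.Fin using (Fin; zero; suc)
open import Data.Fin.Subset using (Subset; _∈_)
open import Data.Vec using (Vec; _∷_; []; lookup)
open import Data.Empty using (⊥-elim)
open import Relation.Binary.PropositionalEquality using (_≡_; refl)

module _ {n : ℕ} (G : Graph n) {X : Subset n} (independent : Independent G X) where

  short-walk-meets-only-ends : ∀ {x y} k (w : Vec (Fin n) (suc k)) → k ≤ 3 →
    x ∈ X → y ∈ X → IsWalk G x y k w →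
    ∀ i → lookup w i ∈ X → lookup w i ≡ x ⊎ lookup w i ≡ y
  short-walk-meets-only-ends 0 (a ∷ []) _ _ _ (refl , refl , _) zero _ = inj₁ refl
  short-walk-meets-only-ends 1 (a ∷ b ∷ []) _ _ _ (refl , refl , _) i _ with i
  ... | zero     = inj₁ refl
  ... | suc zero = inj₂ refl
  short-walk-meets-only-ends 2 (a ∷ b ∷ c ∷ []) _ aX _ (refl , refl , edge) i iX with i
  ... | zero           = inj₁ refl
  ... | suc zero       = ⊥-elim (independent a b aX iX (edge zero))
  ... | suc (suc zero) = inj₂ refl
  short-walk-meets-only-ends 3 (a ∷ b ∷ c ∷ d ∷ []) _ aX dX (refl , refl , edge) i iX with i
  ... | zero                 = inj₁ refl
  ... | suc zero             = ⊥-elim (independent a b aX iX (edge zero))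
  ... | suc (suc zero)       = ⊥-elim (independent c d iX dX (edge (suc (suc zero))))
  ... | suc (suc (suc zero)) = inj₂ refl
  short-walk-meets-only-ends (suc (suc (suc (suc _)))) _ (s≤s (s≤s (s≤s ())))

  independent⇒mutualVisibility : DiamAtMost G 3 → MutualVisibility G X
  independent⇒mutualVisibility diam x y xX yX with diam x y
  ... | d , dist@((w , walk) , _) , d≤3 =
    d , w , (walk , dist) , short-walk-meets-only-ends d w d≤3 xX yX walk

IsMaxSize-transport : ∀ {n} {P Q : Subset n → Set} → (∀ S → P S → Q S) → (∀ S → Q S → P S) →
  ∀ {m} → IsMaxSize P m → IsMaxSize Q m
IsMaxSize-transport P⇒Q Q⇒P ((S , pS , size) , maximal) =
  (S , P⇒Q S pS , size) , λ T qT → maximal T (Q⇒P T qT)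

lemma2p1 : ∀ {n : ℕ} (G : Graph n) → Connected G → DiamAtMost G 3 →
    ∀ (m : ℕ) → (IsMuI G m → IsIndependenceNumber G m) × (IsIndependenceNumber G m → IsMuI G m)
lemma2p1 G _ diam m =
  IsMaxSize-transport (λ _ → proj₂) independent⇒independentMV ,
  IsMaxSize-transport independent⇒independentMV (λ _ → proj₂)
  where
  independent⇒independentMV : ∀ S → Independent G S → IndependentMV G S
  independent⇒independentMV S independent =
    independent⇒mutualVisibility G independent diam , independent
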